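{- If $\omega\in\mathcal{B}_n$ has exactly $j$ descents at odd positions and no descents at even positions, then the permutation $|\omega|=|\omega(1)||\omega(2)|\cdots|\omega(n)|\in\mathfrak{S}_n$ satisfies $\mathrm{lpk}(|\omega|)\le j$.
   Context: $\mathcal{B}_n$ is the set of signed permutations of $\{\pm1,\dots,\pm n\}$ ($\sigma(-i)=-\sigma(i)$), each identified with the word $\sigma(0)\sigma(1)\cdots\sigma(n)$ with $\sigma(0)=0$; a position $i\in\{0,\dots,n-1\}$ is a descent if $\sigma(i)>\sigma(i+1)$, and even positions include $0$. For $u\in\mathfrak{S}_n$, $\mathrm{lpk}(u)=|\{1\le i<n: u(i-1)<u(i)>u(i+1)\}|$ with the convention $u(0)=0$, $u(n+1)=n+1$. -}

module Defs where

open import Data.Nat as ℕ using (ℕ; zero; suc; _≤_)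
open import Data.Nat.Properties using (_<?_)
open import Data.Integer as ℤ using (ℤ; ∣_∣)
open import Data.Integer.Properties as ℤP using ()
open import Data.Fin using (Fin)
open import Data.List using (List; []; _∷_; tabulate; map; length; filter)
open import Data.Bool using (Bool; true; false; if_then_else_)
open import Data.Product using (_×_)
open import Relation.Nullary.Decidable using (⌊_⌋)
open import Relation.Binary.PropositionalEquality using (_≡_)
open import Data.Nat.Properties using (_≟_)
open import Relation.Unary using (Decidable)
open import Function using (_∘_)

-- A signed permutation ω ∈ B_n, given by its values ω(1),…,ω(n) (ω(-i) = -ω(i)
-- and ω(0) = 0 are then determined).  The condition says i ↦ |ω(i)| is a
-- bijection of {1,…,n} (injective self-map of a finite set).
IsSignedPerm : (n : ℕ) → (Fin n → ℤ) → Set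
IsSignedPerm n ω =
  (∀ i → 1 ≤ ∣ ω i ∣ × ∣ ω i ∣ ≤ n) × (∀ i k → ∣ ω i ∣ ≡ ∣ ω k ∣ → i ≡ k)

sword : {n : ℕ} → (Fin n → ℤ) → List ℤ
sword ω = ℤ.0ℤ ∷ tabulate ω

descentsFrom : ℕ → List ℤ → List ℕ
descentsFrom k [] = []
descentsFrom k (x ∷ []) = []
descentsFrom k (x ∷ y ∷ rest) =
  if ⌊ y ℤP.<? x ⌋ then k ∷ descentsFrom (suc k) (y ∷ rest)
                   else descentsFrom (suc k) (y ∷ rest)

sDes : {n : ℕ} → (Fin n → ℤ) → List ℕ
sDes ω = descentsFrom 0 (sword ω)

ℕeven? : Decidable (λ (i : ℕ) → i ℕ.% 2 ≡ 0)
ℕeven? i = i ℕ.% 2 ≟ 0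

evenDes : {n : ℕ} → (Fin n → ℤ) → ℕ
evenDes ω = length (filter ℕeven? (sDes ω))

oddDes : {n : ℕ} → (Fin n → ℤ) → ℕ
oddDes ω = length (filter (λ i → ℕeven? (suc i)) (sDes ω))

peaks : List ℕ → ℕ
peaks [] = 0
peaks (x ∷ []) = 0
peaks (x ∷ y ∷ []) = 0
peaks (x ∷ y ∷ z ∷ rest) =
  (if ⌊ x <? y ⌋ Data.Bool.∧ ⌊ z <? y ⌋ then 1 else 0) ℕ.+ peaks (y ∷ z ∷ rest)

-- lpk(u) for u = u(1)⋯u(n) ∈ S_n with u(0) = 0: peaks at 1 ≤ i < n in the
-- word u(0)u(1)⋯u(n).  (The convention u(n+1) = n+1 is irrelevant since i < n.)
lpk : {n : ℕ} → (Fin n → ℕ) → ℕ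
lpk u = peaks (0 ∷ tabulate u)

absPerm : {n : ℕ} → (Fin n → ℤ) → (Fin n → ℕ)
absPerm ω = ∣_∣ ∘ ω

{-# OPTIONS --safe #-}
module Submission where

-- Let w = 0 ω(1) ⋯ ω(n) and suppose |w| has a peak |x| < |y| > |z| at position p.
-- If position p - 1 is even it is not a descent, so x ≤ y; together with
-- |x| < |y| this forces y > 0, hence z ≤ |z| < y and p is an odd descent.
-- If instead p is even, then y ≤ z and |z| < |y| force y < 0, hence y < x and
-- p - 1 is an odd descent.  Every peak is thus charged to the odd position
-- among {p - 1, p}, and since peaks are never adjacent the charging is
-- injective.  The argument only uses the word structure, never that ω is a
-- signed permutation.

open import Defs
open import Data.Nat using (ℕ; _≤_)
open import Data.Integer using (ℤ)
open import Data.Fin using (Fin)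
open import Relation.Binary.PropositionalEquality using (_≡_)

open import Data.Nat as ℕ using (zero; suc; z≤n; s≤s; _%_)
import Data.Nat.Properties as ℕP
open import Data.Integer as ℤ using (+_; -[1+_]; ∣_∣; +≤+; -≤-; +<+; -<+; -<-)
import Data.Integer.Properties as ℤP
open import Data.List using (List; []; _∷_; map; length; filter)
open import Data.List.Properties using (filter-accept; filter-reject; map-tabulate)
open import Data.Product using (_×_; _,_)
open import Data.Sum using (_⊎_; inj₁; inj₂)
open import Data.Empty using (⊥-elim)
open import Function using (_∘′_)
open import Relation.Nullary using (¬_; Dec; yes; no)
open import Relation.Unary using (Pred; Decidable)
open import Relation.Binary.PropositionalEquality using (refl; cong; sym; trans; subst)

Even : ℕ → Set
Even i = i % 2 ≡ 0

Odd : ℕ → Set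
Odd i = Even (suc i)

even⊎odd : ∀ k → (Even k × ¬ Odd k) ⊎ (¬ Even k × Odd k)
even⊎odd zero          = inj₁ (refl , λ ())
even⊎odd (suc zero)    = inj₂ ((λ ()) , refl)
even⊎odd (suc (suc k)) = even⊎odd k

countDes : ∀ {ℓ} {P : Pred ℕ ℓ} → Decidable P → ℕ → List ℤ → ℕ
countDes P? k w = length (filter P? (descentsFrom k w))

evenDesFrom : ℕ → List ℤ → ℕ
evenDesFrom = countDes ℕeven?

oddDesFrom : ℕ → List ℤ → ℕ
oddDesFrom = countDes (λ i → ℕeven? (suc i))

absPeaks : List ℤ → ℕ
absPeaks w = peaks (map ∣_∣ w)

module _ {ℓ} {P : Pred ℕ ℓ} (P? : Decidable P) (k : ℕ) (x y : ℤ) (w : List ℤ) where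

  private
    rest : List ℕ
    rest = descentsFrom (suc k) (y ∷ w)

  descentsFrom-descent : y ℤ.< x → descentsFrom k (x ∷ y ∷ w) ≡ k ∷ rest
  descentsFrom-descent y<x with y ℤP.<? x
  ... | yes _  = refl
  ... | no y≮x = ⊥-elim (y≮x y<x)

  descentsFrom-ascent : ¬ y ℤ.< x → descentsFrom k (x ∷ y ∷ w) ≡ rest
  descentsFrom-ascent y≮x with y ℤP.<? x
  ... | yes y<x = ⊥-elim (y≮x y<x)
  ... | no _    = refl

  countDes-accept : P k → y ℤ.< x →
                    countDes P? k (x ∷ y ∷ w) ≡ suc (countDes P? (suc k) (y ∷ w))
  countDes-accept Pk y<x =
    trans (cong (length ∘′ filter P?) (descentsFrom-descent y<x))
          (cong length (filter-accept P? Pk))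

  countDes-reject : ¬ P k → y ℤ.< x →
                    countDes P? k (x ∷ y ∷ w) ≡ countDes P? (suc k) (y ∷ w)
  countDes-reject ¬Pk y<x =
    trans (cong (length ∘′ filter P?) (descentsFrom-descent y<x))
          (cong length (filter-reject P? ¬Pk))

  countDes-ascent : ¬ y ℤ.< x →
                    countDes P? k (x ∷ y ∷ w) ≡ countDes P? (suc k) (y ∷ w)
  countDes-ascent y≮x = cong (length ∘′ filter P?) (descentsFrom-ascent y≮x)

  countDes-tail-≤ : countDes P? (suc k) (y ∷ w) ≤ countDes P? k (x ∷ y ∷ w)
  countDes-tail-≤ = by-cases (y ℤP.<? x) (P? k)
    where
    by-cases : Dec (y ℤ.< x) → Dec (P k) → countDes P? (suc k) (y ∷ w) ≤ countDes P? k (x ∷ y ∷ w)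
    by-cases (yes y<x) (yes Pk) = ℕP.≤-trans (ℕP.n≤1+n _) (ℕP.≤-reflexive (sym (countDes-accept Pk y<x)))
    by-cases (yes y<x) (no ¬Pk) = ℕP.≤-reflexive (sym (countDes-reject ¬Pk y<x))
    by-cases (no y≮x)  _        = ℕP.≤-reflexive (sym (countDes-ascent y≮x))

evenDesFrom-tail-≡0 : ∀ k x y w → evenDesFrom k (x ∷ y ∷ w) ≡ 0 → evenDesFrom (suc k) (y ∷ w) ≡ 0
evenDesFrom-tail-≡0 k x y w none =
  ℕP.n≤0⇒n≡0 (subst (_ ≤_) none (countDes-tail-≤ ℕeven? k x y w))

evenDesFrom-≡0⇒ascent : ∀ k x y w → Even k → evenDesFrom k (x ∷ y ∷ w) ≡ 0 → x ℤ.≤ y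
evenDesFrom-≡0⇒ascent k x y w even-k none = ℤP.≮⇒≥ λ y<x →
  ℕP.1+n≢0 (trans (sym (countDes-accept ℕeven? k x y w even-k y<x)) none)

absPeak-leftAscent⇒rightDescent : ∀ x y z → x ℤ.≤ y → ∣ x ∣ ℕ.< ∣ y ∣ → ∣ z ∣ ℕ.< ∣ y ∣ → z ℤ.< y
absPeak-leftAscent⇒rightDescent (+ _)    (+ _) (+ _)    _ _ z<y = +<+ z<y
absPeak-leftAscent⇒rightDescent (+ _)    (+ _) -[1+ _ ] _ _ _   = -<+
absPeak-leftAscent⇒rightDescent -[1+ _ ] (+ _) (+ _)    _ _ z<y = +<+ z<y
absPeak-leftAscent⇒rightDescent -[1+ _ ] (+ _) -[1+ _ ] _ _ _   = -<+
absPeak-leftAscent⇒rightDescent -[1+ _ ] -[1+ _ ] _ (-≤- y≤x) (s≤s x<y) _ = ⊥-elim (ℕP.<⇒≱ x<y y≤x)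

absPeak-rightAscent⇒leftDescent : ∀ x y z → y ℤ.≤ z → ∣ x ∣ ℕ.< ∣ y ∣ → ∣ z ∣ ℕ.< ∣ y ∣ → y ℤ.< x
absPeak-rightAscent⇒leftDescent _        (+ _)    (+ _) (+≤+ y≤z) _ z<y = ⊥-elim (ℕP.<⇒≱ z<y y≤z)
absPeak-rightAscent⇒leftDescent (+ _)    -[1+ _ ] _     _ _ _ = -<+
absPeak-rightAscent⇒leftDescent -[1+ _ ] -[1+ _ ] _     _ (s≤s x<y) _ = -<- x<y

absPeaks-drop-descent : ∀ y z w → ∣ z ∣ ℕ.< ∣ y ∣ → absPeaks (y ∷ z ∷ w) ≡ absPeaks (z ∷ w)
absPeaks-drop-descent y z []      _   = refl
absPeaks-drop-descent y z (_ ∷ _) z<y with ∣ y ∣ ℕP.<? ∣ z ∣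
... | yes y<z = ⊥-elim (ℕP.<-asym y<z z<y)
... | no _    = refl

absPeaks-step : ∀ k x y z w → evenDesFrom k (x ∷ y ∷ z ∷ w) ≡ 0 →
                absPeaks (y ∷ z ∷ w) ≤ oddDesFrom (suc k) (y ∷ z ∷ w) →
                absPeaks (z ∷ w) ≤ oddDesFrom (suc (suc k)) (z ∷ w) →
                absPeaks (x ∷ y ∷ z ∷ w) ≤ oddDesFrom k (x ∷ y ∷ z ∷ w)
absPeaks-step k x y z w none ih₁ ih₂ with ∣ x ∣ ℕP.<? ∣ y ∣ | ∣ z ∣ ℕP.<? ∣ y ∣ | even⊎odd k
... | no _    | _       | _ = ℕP.≤-trans ih₁ (countDes-tail-≤ _ k x y (z ∷ w))
... | yes _   | no _    | _ = ℕP.≤-trans ih₁ (countDes-tail-≤ _ k x y (z ∷ w))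
... | yes ∣x∣<∣y∣ | yes ∣z∣<∣y∣ | inj₁ (even-k , _) = begin
  suc (absPeaks (y ∷ z ∷ w))             ≡⟨ cong suc (absPeaks-drop-descent y z w ∣z∣<∣y∣) ⟩
  suc (absPeaks (z ∷ w))                 ≤⟨ s≤s ih₂ ⟩
  suc (oddDesFrom (suc (suc k)) (z ∷ w)) ≡⟨ countDes-accept _ (suc k) y z w even-k z<y ⟨
  oddDesFrom (suc k) (y ∷ z ∷ w)         ≤⟨ countDes-tail-≤ _ k x y (z ∷ w) ⟩
  oddDesFrom k (x ∷ y ∷ z ∷ w)           ∎
  where
  open ℕP.≤-Reasoning
  -- even-k also witnesses Odd (suc k), since (2 + k) % 2 reduces to k % 2.
  z<y : z ℤ.< y
  z<y = absPeak-leftAscent⇒rightDescent x y z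
           (evenDesFrom-≡0⇒ascent k x y (z ∷ w) even-k none) ∣x∣<∣y∣ ∣z∣<∣y∣
... | yes ∣x∣<∣y∣ | yes ∣z∣<∣y∣ | inj₂ (_ , odd-k) = begin
  suc (absPeaks (y ∷ z ∷ w))           ≤⟨ s≤s ih₁ ⟩
  suc (oddDesFrom (suc k) (y ∷ z ∷ w)) ≡⟨ countDes-accept _ k x y (z ∷ w) odd-k y<x ⟨
  oddDesFrom k (x ∷ y ∷ z ∷ w)         ∎
  where
  open ℕP.≤-Reasoning
  y<x : y ℤ.< x
  y<x = absPeak-rightAscent⇒leftDescent x y z
          (evenDesFrom-≡0⇒ascent (suc k) y z w odd-k (evenDesFrom-tail-≡0 k x y (z ∷ w) none)) ∣x∣<∣y∣ ∣z∣<∣y∣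

absPeaks-≤-oddDesFrom : ∀ k w → evenDesFrom k w ≡ 0 → absPeaks w ≤ oddDesFrom k w
absPeaks-≤-oddDesFrom k []           _    = z≤n
absPeaks-≤-oddDesFrom k (_ ∷ [])     _    = z≤n
absPeaks-≤-oddDesFrom k (_ ∷ _ ∷ []) _    = z≤n
absPeaks-≤-oddDesFrom k (x ∷ y ∷ z ∷ w) none =
  absPeaks-step k x y z w none
    (absPeaks-≤-oddDesFrom (suc k) (y ∷ z ∷ w) none′)
    (absPeaks-≤-oddDesFrom (suc (suc k)) (z ∷ w) (evenDesFrom-tail-≡0 (suc k) y z w none′))
  where
  none′ : evenDesFrom (suc k) (y ∷ z ∷ w) ≡ 0
  none′ = evenDesFrom-tail-≡0 k x y (z ∷ w) none

lemma2p11 : (n j : ℕ) (ω : Fin n → ℤ) → IsSignedPerm n ω →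
    oddDes ω ≡ j → evenDes ω ≡ 0 → lpk (absPerm ω) ≤ j
lemma2p11 n j ω _ refl none =
  subst (λ u → peaks (0 ∷ u) ≤ oddDes ω) (map-tabulate ω ∣_∣)
        (absPeaks-≤-oddDesFrom 0 (sword ω) none)
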